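{- Let $G$ be a finite cyclic group of order $n\ge 2$ with generator $\gamma$, and let $d:G\to G$ be the univariate Diffie-Hellman mapping $d(\gamma^a)=\gamma^{a^2}$, $a=0,1,\ldots,n-1$. Then $$ind(d)=\begin{cases} n, & n \text{ odd},\\ n/2, & n \text{ even}.\end{cases}$$
   Context: For a positive divisor $\ell$ of $n$, let $C_{\ell,0}=\{\gamma^{j\ell}: j=0,1,\ldots,n/\ell-1\}$ (the subgroup of $\ell$-th powers, of index $\ell$ in $G$) and let $C_{\ell,i}=\gamma^i C_{\ell,0}$ for $i=0,1,\ldots,\ell-1$ (the cyclotomic cosets). For a positive integer $r$ and $a_0,\ldots,a_{\ell-1}\in G$, the $r$-th order cyclotomic mapping of index $\ell$ is the map $f^r_{a_0,\ldots,a_{\ell-1}}:G\to G$ given by $f^r_{a_0,\ldots,a_{\ell-1}}(x)=a_i x^r$ if $x\in C_{\ell,i}$, $i=0,\ldots,\ell-1$. For a self-mapping $f$ of $G$, $ind(f)$ denotes the smallest positive divisor $\ell$ of $n$ such that $f=f^r_{a_0,\ldots,a_{\ell-1}}$ for some positive integer $r$ and some $a_0,\ldots,a_{\ell-1}\in G$. -}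

module Defs where

open import Data.Nat using (ℕ; _+_; _*_; _<_; _≤_; NonZero)
open import Data.Nat.DivMod using (_mod_)
open import Data.Nat.Divisibility using (_∣_)
open import Data.Fin using (Fin; toℕ)
open import Data.Product using (Σ; _×_)
open import Relation.Binary.PropositionalEquality using (_≡_)

-- The cyclic group G of order n with generator γ.  Every element of G is
-- uniquely γ^a with 0 ≤ a < n; we represent γ^a by the exponent a : Fin n.
G : ℕ → Set
G n = Fin n

module _ (n : ℕ) .{{_ : NonZero n}} where

  γ^ : ℕ → G n
  γ^ a = a mod n

  mul : G n → G n → G n
  mul x y = γ^ (toℕ x + toℕ y)

  pow : G n → ℕ → G n
  pow x r = γ^ (toℕ x * r)

  -- x ∈ C_{ℓ,i} = γ^i C_{ℓ,0},  C_{ℓ,0} = {γ^(jℓ) : j = 0,…,n/ℓ-1}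
  -- (for ℓ ∣ n, the condition j < n/ℓ is written j * ℓ < n)
  InCoset : (ℓ i : ℕ) → G n → Set
  InCoset ℓ i x = Σ ℕ λ j → (j * ℓ < n) × (x ≡ mul (γ^ i) (γ^ (j * ℓ)))

  IsCyclotomic : (ℓ : ℕ) → (G n → G n) → Set
  IsCyclotomic ℓ f =
    Σ ℕ λ r → (1 ≤ r) × Σ (Fin ℓ → G n) λ a →
      ∀ (i : Fin ℓ) (x : G n) → InCoset ℓ (toℕ i) x → f x ≡ mul (a i) (pow x r)

  IndexIs : (G n → G n) → ℕ → Set
  IndexIs f m =
    (1 ≤ m) × (m ∣ n) × IsCyclotomic m f ×
    (∀ ℓ → 1 ≤ ℓ → ℓ ∣ n → IsCyclotomic ℓ f → m ≤ ℓ)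

  dh : G n → G n
  dh x = γ^ (toℕ x * toℕ x)

module Submission where

-- Read on exponents, with a_i = γ^(c_i), dh agrees with x ↦ a_i x^r on the coset
-- of γ^i exactly when y² ≡ c_i + y r (mod n) for all y = i + jℓ with jℓ < n.
-- If ℓ < n, two points y and y + ℓ of one coset give (y + ℓ)² − y² ≡ ℓ r; doing
-- this for y = 0 and y = 1 and subtracting gives 2ℓ ≡ 0, so n = 2ℓ.  Conversely,
-- if n ∣ 2ℓ each coset holds at most the points i and i + ℓ, and r = ℓ,
-- c_i = i² − iℓ work.

open import Defs
open import Data.Nat using (ℕ; suc; pred; _+_; _*_; _/_; _%_; _≤_; _<_; z≤n; s≤s; _≤?_; NonZero)
open import Data.Nat.Properties
open import Data.Nat.DivMod using (m%n<n; m%n%n≡m%n; %-distribˡ-+; %-distribˡ-*; %-remove-+ˡ; m*n%n≡0; m*n/n≡m)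
open import Data.Nat.Divisibility using (_∣_; divides; ∣-refl; ∣⇒≤; n∣m*n; m%n≡0⇒n∣m)
open import Data.Nat.Tactic.RingSolver using (solve-∀)
open import Data.Fin using (Fin; toℕ) renaming (zero to fz; suc to fs)
open import Data.Fin.Properties using (toℕ-fromℕ<; toℕ-injective)
open import Data.Product using (_×_; _,_)
open import Data.Sum using (_⊎_; inj₁; inj₂)
open import Data.Empty using (⊥-elim)
open import Function.Bundles using (_⇔_; mk⇔; Equivalence)
open import Relation.Nullary using (¬_; yes; no)
open import Relation.Binary.PropositionalEquality

module DiffieHellman (n : ℕ) .{{_ : NonZero n}} where
  open ≡-Reasoning

  infix 4 _≋_
  _≋_ : ℕ → ℕ → Set
  a ≋ b = a % n ≡ b % n

  ≋-+ : ∀ {a b c d} → a ≋ b → c ≋ d → a + c ≋ b + d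
  ≋-+ {a} {b} {c} {d} a≋b c≋d = begin
    (a + c) % n             ≡⟨ %-distribˡ-+ a c n ⟩
    (a % n + c % n) % n     ≡⟨ cong₂ (λ u v → (u + v) % n) a≋b c≋d ⟩
    (b % n + d % n) % n     ≡⟨ %-distribˡ-+ b d n ⟨
    (b + d) % n             ∎

  ≋-* : ∀ {a b c d} → a ≋ b → c ≋ d → a * c ≋ b * d
  ≋-* {a} {b} {c} {d} a≋b c≋d = begin
    (a * c) % n             ≡⟨ %-distribˡ-* a c n ⟩
    (a % n * (c % n)) % n   ≡⟨ cong₂ (λ u v → (u * v) % n) a≋b c≋d ⟩
    (b % n * (d % n)) % n   ≡⟨ %-distribˡ-* b d n ⟨
    (b * d) % n             ∎

  +-*n-≋ : ∀ a k → a + k * n ≋ a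
  +-*n-≋ a k = trans (cong (_% n) (+-comm a (k * n))) (%-remove-+ˡ a (n∣m*n k))

  -- a * pred n + a is a multiple of n.
  +-cancelˡ-≋ : ∀ a {b c} → a + b ≋ a + c → b ≋ c
  +-cancelˡ-≋ a {b} {c} h = trans (sym (undo b)) (trans (≋-+ {a * pred n} refl h) (undo c))
    where
    undo : ∀ b → a * pred n + (a + b) ≋ b
    undo b = begin
      (a * pred n + (a + b)) % n   ≡⟨ cong (_% n) (reorder a (pred n) b) ⟩
      (b + a * suc (pred n)) % n   ≡⟨ cong (λ m → (b + a * m) % n) (suc-pred n) ⟩
      (b + a * n) % n              ≡⟨ +-*n-≋ b a ⟩
      b % n                        ∎
      where
      reorder : ∀ a m b → a * m + (a + b) ≡ b + a * suc m
      reorder = solve-∀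

  ≋0⇒∣ : ∀ a → a ≋ 0 → n ∣ a
  ≋0⇒∣ a a≋0 = m%n≡0⇒n∣m a n (trans a≋0 (m*n%n≡0 0 n))

  toℕ-γ^ : ∀ a → toℕ (γ^ n a) ≋ a
  toℕ-γ^ a = trans (cong (_% n) (toℕ-fromℕ< (m%n<n a n))) (m%n%n≡m%n a n)

  γ^-≡⇔≋ : ∀ a b → γ^ n a ≡ γ^ n b ⇔ a ≋ b
  γ^-≡⇔≋ a b = mk⇔
    (λ eq → trans (sym (toℕ-γ^ a)) (trans (cong (λ x → toℕ x % n) eq) (toℕ-γ^ b)))
    (λ a≋b → toℕ-injective (trans (toℕ-fromℕ< _) (trans a≋b (sym (toℕ-fromℕ< _)))))

  SquareLaw : (c r y : ℕ) → Set
  SquareLaw c r y = y * y ≋ c + y * r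

  SquareLaw-resp-≋ : ∀ {c c′ r y y′} → c ≋ c′ → y ≋ y′ → SquareLaw c r y → SquareLaw c′ r y′
  SquareLaw-resp-≋ {c} {c′} {r} {y} {y′} c≋c′ y≋y′ law =
    trans (sym (≋-* y≋y′ y≋y′)) (trans law (≋-+ c≋c′ (≋-* y≋y′ refl)))

  dh≡mul-pow⇔SquareLaw : ∀ x c r → dh n x ≡ mul n c (pow n x r) ⇔ SquareLaw (toℕ c) r (toℕ x)
  dh≡mul-pow⇔SquareLaw x c r = mk⇔
    (λ eq → trans (Equivalence.to (γ^-≡⇔≋ _ _) eq) (≋-+ {toℕ c} refl (toℕ-γ^ _)))
    (λ law → Equivalence.from (γ^-≡⇔≋ _ _) (trans law (≋-+ {toℕ c} refl (sym (toℕ-γ^ _)))))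

  toℕ-mul-γ^ : ∀ a b → toℕ (mul n (γ^ n a) (γ^ n b)) ≋ a + b
  toℕ-mul-γ^ a b = trans (toℕ-γ^ _) (≋-+ (toℕ-γ^ a) (toℕ-γ^ b))

  CosetLaw : (ℓ r : ℕ) → (Fin ℓ → G n) → Set
  CosetLaw ℓ r a = ∀ (i : Fin ℓ) j → j * ℓ < n → SquareLaw (toℕ (a i)) r (toℕ i + j * ℓ)

  dh-cyclotomic⇔CosetLaw : ∀ ℓ r (a : Fin ℓ → G n) →
    (∀ i x → InCoset n ℓ (toℕ i) x → dh n x ≡ mul n (a i) (pow n x r)) ⇔ CosetLaw ℓ r a
  dh-cyclotomic⇔CosetLaw ℓ r a = mk⇔
    (λ h i j jℓ<n → SquareLaw-resp-≋ refl (toℕ-mul-γ^ (toℕ i) (j * ℓ))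
      (Equivalence.to (dh≡mul-pow⇔SquareLaw (mul n (γ^ n (toℕ i)) (γ^ n (j * ℓ))) (a i) r)
        (h i _ (j , jℓ<n , refl))))
    (λ law i x → λ { (j , jℓ<n , refl) → Equivalence.from (dh≡mul-pow⇔SquareLaw x (a i) r)
      (SquareLaw-resp-≋ refl (sym (toℕ-mul-γ^ (toℕ i) (j * ℓ))) (law i j jℓ<n)) })

  square-shift : ∀ {c r} y ℓ → SquareLaw c r y → SquareLaw c r (y + ℓ) →
                 (y + ℓ) * (y + ℓ) ≋ y * y + ℓ * r
  square-shift {c} {r} y ℓ law law′ = begin
    ((y + ℓ) * (y + ℓ)) % n   ≡⟨ law′ ⟩
    (c + (y + ℓ) * r) % n     ≡⟨ cong (_% n) (regroup c y ℓ r) ⟩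
    (c + y * r + ℓ * r) % n   ≡⟨ ≋-+ {c + y * r} (sym law) refl ⟩
    (y * y + ℓ * r) % n       ∎
    where
    regroup : ∀ c y ℓ r → c + (y + ℓ) * r ≡ c + y * r + ℓ * r
    regroup = solve-∀

  CosetLaw-shift : ∀ {ℓ r a} → CosetLaw ℓ r a → ∀ (i : Fin ℓ) j y → y ≡ toℕ i + j * ℓ → suc j * ℓ < n →
                   (y + ℓ) * (y + ℓ) ≋ y * y + ℓ * r
  CosetLaw-shift {ℓ} {r} {a} law i j y refl [1+j]ℓ<n = square-shift (toℕ i + j * ℓ) ℓ
    (law i j (≤-<-trans (m≤n+m (j * ℓ) ℓ) [1+j]ℓ<n))
    (SquareLaw-resp-≋ refl (cong (_% n) (next-in-coset (toℕ i) j ℓ)) (law i (suc j) [1+j]ℓ<n))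
    where
    next-in-coset : ∀ t j ℓ → t + (1 + j) * ℓ ≡ t + j * ℓ + ℓ
    next-in-coset = solve-∀

  shifts⇒∣2ℓ : ∀ ℓ r → ℓ * ℓ ≋ ℓ * r → (1 + ℓ) * (1 + ℓ) ≋ 1 + ℓ * r → n ∣ 2 * ℓ
  shifts⇒∣2ℓ ℓ r shift₀ shift₁ = ≋0⇒∣ (2 * ℓ) (+-cancelˡ-≋ (1 + ℓ * ℓ) (begin
    (1 + ℓ * ℓ + 2 * ℓ) % n   ≡⟨ cong (_% n) (binomial ℓ) ⟩
    ((1 + ℓ) * (1 + ℓ)) % n   ≡⟨ shift₁ ⟩
    (1 + ℓ * r) % n           ≡⟨ ≋-+ {1} refl (sym shift₀) ⟩
    (1 + ℓ * ℓ) % n           ≡⟨ cong (_% n) (+-identityʳ (1 + ℓ * ℓ)) ⟨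
    (1 + ℓ * ℓ + 0) % n       ∎))
    where
    binomial : ∀ ℓ → 1 + ℓ * ℓ + 2 * ℓ ≡ (1 + ℓ) * (1 + ℓ)
    binomial = solve-∀

  -- y = 0 and y = 1 lie in cosets 0 and 1 together with y + ℓ; for ℓ = 1 both
  -- lie in the single coset, which then needs n > 2.
  CosetLaw⇒∣2ℓ : ∀ ℓ r (a : Fin ℓ → G n) → 1 ≤ ℓ → ℓ < n → CosetLaw ℓ r a → n ∣ 2 * ℓ
  CosetLaw⇒∣2ℓ 1 r a _ 1<n law with n ≤? 2
  ... | yes n≤2 = subst (_∣ 2) (≤-antisym 1<n n≤2) ∣-refl
  ... | no n≰2  = shifts⇒∣2ℓ 1 r
    (CosetLaw-shift law fz 0 0 refl 1<n) (CosetLaw-shift law fz 1 1 refl (≰⇒> n≰2))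
  CosetLaw⇒∣2ℓ ℓ@(suc (suc _)) r a _ ℓ<n law = shifts⇒∣2ℓ ℓ r
    (CosetLaw-shift law fz 0 0 refl ℓ+0<n) (CosetLaw-shift law (fs fz) 0 1 refl ℓ+0<n)
    where
    ℓ+0<n : ℓ + 0 < n
    ℓ+0<n = subst (_< n) (sym (+-identityʳ ℓ)) ℓ<n

  *-idem-<2 : ∀ {j} → j < 2 → j * j ≡ j
  *-idem-<2 (s≤s z≤n)       = refl
  *-idem-<2 (s≤s (s≤s z≤n)) = refl

  -- a_i = γ^(i² − iℓ), with −iℓ written as iℓ(n − 1).
  ∣2ℓ⇒CosetLaw : ∀ ℓ → 1 ≤ ℓ → n ∣ 2 * ℓ →
                 CosetLaw ℓ ℓ (λ i → γ^ n (toℕ i * toℕ i + toℕ i * ℓ * pred n))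
  ∣2ℓ⇒CosetLaw ℓ@(suc _) _ n∣2ℓ@(divides k 2ℓ≡kn) i j jℓ<n =
    SquareLaw-resp-≋ {y = t + j * ℓ} (sym (toℕ-γ^ _)) refl (begin
      ((t + j * ℓ) * (t + j * ℓ)) % n                ≡⟨ cong (_% n) (expand-square t j ℓ) ⟩
      (t * t + j * j * (ℓ * ℓ) + j * t * (2 * ℓ)) % n ≡⟨ cong₂ (λ u v → (t * t + u * (ℓ * ℓ) + j * t * v) % n) j*j≡j 2ℓ≡kn ⟩
      (t * t + j * (ℓ * ℓ) + j * t * (k * n)) % n    ≡⟨ cong (λ u → (t * t + j * (ℓ * ℓ) + u) % n) (*-assoc (j * t) k n) ⟨
      (t * t + j * (ℓ * ℓ) + j * t * k * n) % n      ≡⟨ +-*n-≋ _ (j * t * k) ⟩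
      (t * t + j * (ℓ * ℓ)) % n                      ≡⟨ +-*n-≋ _ (t * ℓ) ⟨
      (t * t + j * (ℓ * ℓ) + t * ℓ * n) % n          ≡⟨ cong (λ u → (t * t + j * (ℓ * ℓ) + t * ℓ * u) % n) (suc-pred n) ⟨
      (t * t + j * (ℓ * ℓ) + t * ℓ * suc (pred n)) % n ≡⟨ cong (_% n) (expand-rhs t j ℓ (pred n)) ⟨
      (t * t + t * ℓ * pred n + (t + j * ℓ) * ℓ) % n ∎)
    where
    t : ℕ
    t = toℕ i
    j*j≡j : j * j ≡ j
    j*j≡j = *-idem-<2 (*-cancelʳ-< ℓ j 2 (<-≤-trans jℓ<n (∣⇒≤ n∣2ℓ)))
    expand-square : ∀ t j ℓ → (t + j * ℓ) * (t + j * ℓ) ≡ t * t + j * j * (ℓ * ℓ) + j * t * (2 * ℓ)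
    expand-square = solve-∀
    expand-rhs : ∀ t j ℓ m → t * t + t * ℓ * m + (t + j * ℓ) * ℓ ≡ t * t + j * (ℓ * ℓ) + t * ℓ * suc m
    expand-rhs = solve-∀

  ∣2ℓ⇒cyclotomic : ∀ ℓ → 1 ≤ ℓ → n ∣ 2 * ℓ → IsCyclotomic n ℓ (dh n)
  ∣2ℓ⇒cyclotomic ℓ 1≤ℓ n∣2ℓ = ℓ , 1≤ℓ , _ ,
    Equivalence.from (dh-cyclotomic⇔CosetLaw ℓ ℓ _) (∣2ℓ⇒CosetLaw ℓ 1≤ℓ n∣2ℓ)

  ∣2ℓ⇒≡2ℓ : ∀ ℓ → 1 ≤ ℓ → ℓ < n → n ∣ 2 * ℓ → n ≡ 2 * ℓ
  ∣2ℓ⇒≡2ℓ ℓ@(suc _) _ ℓ<n (divides k 2ℓ≡kn)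
    with *-cancelʳ-< n k 2 (subst (_< 2 * n) 2ℓ≡kn (*-monoʳ-< 2 ℓ<n))
  ... | s≤s z≤n       = ⊥-elim (1+n≢0 2ℓ≡kn)
  ... | s≤s (s≤s z≤n) = trans (sym (+-identityʳ n)) (sym 2ℓ≡kn)

  cyclotomic⇒n≤ℓ⊎n≡2ℓ : ∀ ℓ → 1 ≤ ℓ → IsCyclotomic n ℓ (dh n) → n ≤ ℓ ⊎ n ≡ 2 * ℓ
  cyclotomic⇒n≤ℓ⊎n≡2ℓ ℓ 1≤ℓ (r , _ , a , h) with n ≤? ℓ
  ... | yes n≤ℓ = inj₁ n≤ℓ
  ... | no n≰ℓ  = inj₂ (∣2ℓ⇒≡2ℓ ℓ 1≤ℓ ℓ<n
                   (CosetLaw⇒∣2ℓ ℓ r a 1≤ℓ ℓ<n (Equivalence.to (dh-cyclotomic⇔CosetLaw ℓ r a) h)))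
    where
    ℓ<n : ℓ < n
    ℓ<n = ≰⇒> n≰ℓ

  index-odd : 1 ≤ n → ¬ (2 ∣ n) → IndexIs n (dh n) n
  index-odd 1≤n 2∤n = 1≤n , ∣-refl , ∣2ℓ⇒cyclotomic n 1≤n (n∣m*n 2) , minimal
    where
    minimal : ∀ ℓ → 1 ≤ ℓ → ℓ ∣ n → IsCyclotomic n ℓ (dh n) → n ≤ ℓ
    minimal ℓ 1≤ℓ _ cyc with cyclotomic⇒n≤ℓ⊎n≡2ℓ ℓ 1≤ℓ cyc
    ... | inj₁ n≤ℓ  = n≤ℓ
    ... | inj₂ n≡2ℓ = ⊥-elim (2∤n (divides ℓ (trans n≡2ℓ (*-comm 2 ℓ))))

  index-half : ∀ q → 1 ≤ q → n ≡ 2 * q → IndexIs n (dh n) q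
  index-half q 1≤q n≡2q =
    1≤q , divides 2 n≡2q , ∣2ℓ⇒cyclotomic q 1≤q (subst (n ∣_) n≡2q ∣-refl) , minimal
    where
    minimal : ∀ ℓ → 1 ≤ ℓ → ℓ ∣ n → IsCyclotomic n ℓ (dh n) → q ≤ ℓ
    minimal ℓ 1≤ℓ _ cyc with cyclotomic⇒n≤ℓ⊎n≡2ℓ ℓ 1≤ℓ cyc
    ... | inj₁ n≤ℓ  = ≤-trans (subst (q ≤_) (sym n≡2q) (m≤n*m q 2)) n≤ℓ
    ... | inj₂ n≡2ℓ = ≤-reflexive (*-cancelˡ-≡ q ℓ 2 (trans (sym n≡2q) n≡2ℓ))

open DiffieHellman using (index-odd; index-half)

theorem1 : (n : ℕ) .{{_ : NonZero n}} → 2 ≤ n →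
           (¬ (2 ∣ n) → IndexIs n (dh n) n) × (2 ∣ n → IndexIs n (dh n) (n / 2))
theorem1 n 2≤n = index-odd n (≤-trans (s≤s z≤n) 2≤n) , index-even
  where
  index-even : 2 ∣ n → IndexIs n (dh n) (n / 2)
  index-even (divides q n≡q*2) =
    subst (IndexIs n (dh n)) (sym (trans (cong (_/ 2) n≡q*2) (m*n/n≡m q 2)))
      (index-half n q (*-cancelˡ-≤ 2 (subst (2 ≤_) n≡2q 2≤n)) n≡2q)
    where
    n≡2q : n ≡ 2 * q
    n≡2q = trans n≡q*2 (*-comm q 2)
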